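{- Let $n\ge1$ and let $x_1,\dots,x_n,y,\alpha$ be indeterminates. Then, as an identity of rational functions in $\mathbb Q(x_1,\dots,x_n,y,\alpha)$, $$\Bigl(1-\frac{y+1-\alpha}{\alpha}\Bigr)\prod_{i=1}^n\frac{x_i-y+\alpha-1}{x_i-y+\alpha}+\frac{y+1-\alpha}{\alpha}\prod_{i=1}^n\frac{x_i-y-1}{x_i-y} =1-\sum_{i=1}^n\frac{\alpha}{(x_i-y+\alpha)(x_i-y)}\cdot\frac{x_i+1-\alpha}{\alpha}\prod_{k\neq i}\frac{x_k-x_i-1}{x_k-x_i}.$$ -}

module Defs where

open import Data.Nat using (ℕ; zero; suc)
open import Data.Fin using (Fin; zero; suc)
import Data.Fin as F
open import Data.Rational using (ℚ; 0ℚ; 1ℚ; _*_; _÷_; ≢-nonZero)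
open import Data.Rational.Properties using (_≟_)
open import Relation.Nullary using (yes; no)

-- Total division on ℚ (convention: p /' 0 = 0).  Only ever used in the
-- statement under hypotheses guaranteeing the denominator is nonzero.
infixl 7 _/'_
_/'_ : ℚ → ℚ → ℚ
p /' q with q ≟ 0ℚ
... | yes _ = 0ℚ
... | no q≢0 = _÷_ p q {{≢-nonZero q≢0}}

prod : ∀ {n} → (Fin n → ℚ) → ℚ
prod {zero} f = 1ℚ
prod {suc n} f = f zero * prod (λ i → f (suc i))

sum : ∀ {n} → (Fin n → ℚ) → ℚ
sum {zero} f = 0ℚ
sum {suc n} f = f zero Data.Rational.+ sum (λ i → f (suc i))

prodExcept : ∀ {n} → Fin n → (Fin n → ℚ) → ℚ
prodExcept i f = prod (λ k → g k (k F.≟ i))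
  where
  g : ∀ k → _ → ℚ
  g k (yes _) = 1ℚ
  g k (no _) = f k

{-# OPTIONS --safe #-}
module Submission where

-- Write r_i = ∏_{k≠i} (x_k - x_i - 1)/(x_k - x_i).  As a rational function of t,
-- ∏_k (x_k - t - 1)/(x_k - t) tends to 1 at infinity and has a simple pole at each x_i
-- with residue r_i, so it equals 1 - Σ_i r_i/(x_i - t) (partialFractions); this is proved
-- by induction on n, splitting off x_0 and using the smaller identity both at t and at
-- t = x_0.  The theorem is the affine combination, with weights 1 - c and c where
-- c = (y + 1 - α)/α, of this expansion at t = y - α and at t = y, and termwise
-- (1 - c)/(u + α) + c/u = (u + cα)/(u(u + α)) with u + cα = x_i + 1 - α for u = x_i - y.

open import Defs
open import Data.Nat using (ℕ; zero; suc; _≤_)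
open import Data.Fin using (Fin; zero; suc)
import Data.Fin as Fin
open import Data.Fin.Properties using (suc-injective)
open import Data.List using (_∷_; [])
open import Data.Rational using (ℚ; 0ℚ; 1ℚ; _+_; _-_; _*_; -_; ≢-nonZero)
open import Data.Rational.Properties
  using (_≟_; +-*-commutativeRing; *-identityˡ; *-identityʳ; *-zeroˡ; *-zeroʳ; *-inverseʳ; 1≢0)
open import Function using (_∘_)
open import Level using (0ℓ)
open import Relation.Binary.PropositionalEquality
open import Relation.Nullary using (yes; no; contradiction)
open import Relation.Nullary.Decidable.Core using (dec⇒maybe)
open import Tactic.RingSolver using (solve-∀; solve)
open import Tactic.RingSolver.Core.AlmostCommutativeRing
  using (AlmostCommutativeRing; fromCommutativeRing)

open ≡-Reasoning

ℚ-ring : AlmostCommutativeRing 0ℓ 0ℓ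
ℚ-ring = fromCommutativeRing +-*-commutativeRing (λ q → dec⇒maybe (0ℚ ≟ q))

-- Identities involving an inverse take it as a separate variable together with the hypothesis
-- q * q⁻¹ ≡ 1ℚ, so that the ring solver can treat the inverse as an atom.
inverse-unique : ∀ q v w → q * v ≡ 1ℚ → q * w ≡ 1ℚ → v ≡ w
inverse-unique q v w qv≡1 qw≡1 = begin
  v            ≡⟨ *-identityʳ v ⟨
  v * 1ℚ       ≡⟨ cong (v *_) qw≡1 ⟨
  v * (q * w)  ≡⟨ solve (q ∷ v ∷ w ∷ []) ℚ-ring ⟩
  (q * v) * w  ≡⟨ cong (_* w) qv≡1 ⟩
  1ℚ * w       ≡⟨ *-identityˡ w ⟩
  w            ∎

inverse-sub-swap : ∀ p q w → (q - p) * w ≡ 1ℚ → (p - q) * (- w) ≡ 1ℚ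
inverse-sub-swap p q w [q-p]w≡1 = begin
  (p - q) * (- w)  ≡⟨ solve (p ∷ q ∷ w ∷ []) ℚ-ring ⟩
  (q - p) * w      ≡⟨ [q-p]w≡1 ⟩
  1ℚ               ∎

inverse-* : ∀ p p⁻¹ q q⁻¹ → p * p⁻¹ ≡ 1ℚ → q * q⁻¹ ≡ 1ℚ → (p * q) * (p⁻¹ * q⁻¹) ≡ 1ℚ
inverse-* p p⁻¹ q q⁻¹ pp⁻¹≡1 qq⁻¹≡1 = begin
  (p * q) * (p⁻¹ * q⁻¹)    ≡⟨ solve (p ∷ p⁻¹ ∷ q ∷ q⁻¹ ∷ []) ℚ-ring ⟩
  (p * p⁻¹) * (q * q⁻¹)    ≡⟨ cong₂ _*_ pp⁻¹≡1 qq⁻¹≡1 ⟩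
  1ℚ * 1ℚ                  ≡⟨⟩
  1ℚ                       ∎

inverse-pred : ∀ q q⁻¹ → q * q⁻¹ ≡ 1ℚ → (q - 1ℚ) * q⁻¹ ≡ 1ℚ - q⁻¹
inverse-pred q q⁻¹ qq⁻¹≡1 = begin
  (q - 1ℚ) * q⁻¹   ≡⟨ solve (q ∷ q⁻¹ ∷ []) ℚ-ring ⟩
  q * q⁻¹ - q⁻¹    ≡⟨ cong (_- q⁻¹) qq⁻¹≡1 ⟩
  1ℚ - q⁻¹         ∎

inverse-partialFraction : ∀ b b⁻¹ d d⁻¹ a⁻¹ → b * b⁻¹ ≡ 1ℚ → d * d⁻¹ ≡ 1ℚ → (b + d) * a⁻¹ ≡ 1ℚ →
  b⁻¹ * d⁻¹ ≡ a⁻¹ * (b⁻¹ + d⁻¹)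
inverse-partialFraction b b⁻¹ d d⁻¹ a⁻¹ bb⁻¹≡1 dd⁻¹≡1 aa⁻¹≡1 = begin
  b⁻¹ * d⁻¹                                    ≡⟨ solve (b⁻¹ ∷ d⁻¹ ∷ []) ℚ-ring ⟩
  1ℚ * (b⁻¹ * d⁻¹)                             ≡⟨ cong (_* (b⁻¹ * d⁻¹)) aa⁻¹≡1 ⟨
  (b + d) * a⁻¹ * (b⁻¹ * d⁻¹)                  ≡⟨ solve (b ∷ b⁻¹ ∷ d ∷ d⁻¹ ∷ a⁻¹ ∷ []) ℚ-ring ⟩
  a⁻¹ * ((b * b⁻¹) * d⁻¹ + (d * d⁻¹) * b⁻¹)    ≡⟨ cong₂ (λ u v → a⁻¹ * (u * d⁻¹ + v * b⁻¹)) bb⁻¹≡1 dd⁻¹≡1 ⟩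
  a⁻¹ * (1ℚ * d⁻¹ + 1ℚ * b⁻¹)                  ≡⟨ solve (a⁻¹ ∷ b⁻¹ ∷ d⁻¹ ∷ []) ℚ-ring ⟩
  a⁻¹ * (b⁻¹ + d⁻¹)                            ∎

recip : ℚ → ℚ
recip q = 1ℚ /' q

/'≡*recip : ∀ p q → p /' q ≡ p * recip q
/'≡*recip p q with q ≟ 0ℚ
... | yes _ = sym (*-zeroʳ p)
... | no _  = cong (p *_) (sym (*-identityˡ _))

*-recipʳ : ∀ {q} → q ≢ 0ℚ → q * recip q ≡ 1ℚ
*-recipʳ {q} q≢0 with q ≟ 0ℚ
... | yes q≡0 = contradiction q≡0 q≢0
... | no q≢0′ = trans (cong (q *_) (*-identityˡ _)) (*-inverseʳ q {{≢-nonZero q≢0′}})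

recip-unique : ∀ q {w} → q * w ≡ 1ℚ → recip q ≡ w
recip-unique q {w} qw≡1 = inverse-unique q (recip q) w (*-recipʳ q≢0) qw≡1
  where
  q≢0 : q ≢ 0ℚ
  q≢0 refl = 1≢0 (trans (sym qw≡1) (*-zeroˡ w))

recip-sub-swap : ∀ p q → q - p ≢ 0ℚ → recip (p - q) ≡ - recip (q - p)
recip-sub-swap p q q-p≢0 = recip-unique (p - q) (inverse-sub-swap p q (recip (q - p)) (*-recipʳ q-p≢0))

recip-* : ∀ {p q} → p ≢ 0ℚ → q ≢ 0ℚ → recip (p * q) ≡ recip p * recip q
recip-* {p} {q} p≢0 q≢0 =
  recip-unique (p * q) (inverse-* p (recip p) q (recip q) (*-recipʳ p≢0) (*-recipʳ q≢0))

pred-/'-self : ∀ {q} → q ≢ 0ℚ → (q - 1ℚ) /' q ≡ 1ℚ - recip q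
pred-/'-self {q} q≢0 = trans (/'≡*recip (q - 1ℚ) q) (inverse-pred q (recip q) (*-recipʳ q≢0))

recip-partialFraction : ∀ {a b d} → b + d ≡ a → b ≢ 0ℚ → d ≢ 0ℚ → a ≢ 0ℚ →
  recip b * recip d ≡ recip a * (recip b + recip d)
recip-partialFraction {b = b} {d} refl b≢0 d≢0 b+d≢0 =
  inverse-partialFraction b (recip b) d (recip d) (recip (b + d)) (*-recipʳ b≢0) (*-recipʳ d≢0) (*-recipʳ b+d≢0)

prod-cong : ∀ {n} {f g : Fin n → ℚ} → (∀ k → f k ≡ g k) → prod f ≡ prod g
prod-cong {zero}  f≗g = refl
prod-cong {suc n} f≗g = cong₂ _*_ (f≗g zero) (prod-cong (f≗g ∘ suc))

sum-cong : ∀ {n} {f g : Fin n → ℚ} → (∀ k → f k ≡ g k) → sum f ≡ sum g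
sum-cong {zero}  f≗g = refl
sum-cong {suc n} f≗g = cong₂ _+_ (f≗g zero) (sum-cong (f≗g ∘ suc))

sum-linear : ∀ {n} p q (f g : Fin n → ℚ) → sum (λ i → p * f i + q * g i) ≡ p * sum f + q * sum g
sum-linear {zero}  p q f g = solve (p ∷ q ∷ []) ℚ-ring
sum-linear {suc n} p q f g = begin
  (p * f zero + q * g zero) + sum (λ i → p * f (suc i) + q * g (suc i))
    ≡⟨ cong (p * f zero + q * g zero +_) (sum-linear p q (f ∘ suc) (g ∘ suc)) ⟩
  (p * f zero + q * g zero) + (p * sum (f ∘ suc) + q * sum (g ∘ suc))
    ≡⟨ regroup p q (f zero) (g zero) (sum (f ∘ suc)) (sum (g ∘ suc)) ⟩
  p * (f zero + sum (f ∘ suc)) + q * (g zero + sum (g ∘ suc))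
    ∎
  where
  regroup : ∀ p q a b c d → (p * a + q * b) + (p * c + q * d) ≡ p * (a + c) + q * (b + d)
  regroup = solve-∀ ℚ-ring

-- The factors of prodExcept are computed by a function local to Defs that cannot be named
-- here, so the type of prodExcept-factor-suc is left to be inferred from its use.
mutual
  prodExcept-suc : ∀ {n} (i : Fin n) (f : Fin (suc n) → ℚ) →
    prodExcept (suc i) f ≡ f zero * prodExcept i (f ∘ suc)
  prodExcept-suc i f = cong (f zero *_) (prod-cong (prodExcept-factor-suc i f))

  prodExcept-factor-suc : ∀ {n} (i : Fin n) (f : Fin (suc n) → ℚ) (k : Fin n) → _
  prodExcept-factor-suc i f k with k Fin.≟ i
  ... | yes _ = refl
  ... | no _  = refl

partialFraction-step : ∀ x₀ xᵢ t R → x₀ - t ≢ 0ℚ → xᵢ - t ≢ 0ℚ → x₀ - xᵢ ≢ 0ℚ →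
  (x₀ - xᵢ - 1ℚ) /' (x₀ - xᵢ) * R /' (xᵢ - t)
    ≡ (1ℚ - recip (x₀ - t)) * (R /' (xᵢ - t)) + recip (x₀ - t) * (R /' (xᵢ - x₀))
partialFraction-step x₀ xᵢ t R a≢0 b≢0 d≢0 = begin
  (d - 1ℚ) /' d * R /' b
    ≡⟨ /'≡*recip ((d - 1ℚ) /' d * R) b ⟩
  (d - 1ℚ) /' d * R * recip b
    ≡⟨ cong (λ z → z * R * recip b) (pred-/'-self d≢0) ⟩
  (1ℚ - recip d) * R * recip b
    ≡⟨ split (recip a) (recip b) (recip d) (recip-partialFraction b+d≡a b≢0 d≢0 a≢0) ⟩
  (1ℚ - recip a) * (R * recip b) + recip a * (R * - recip d)
    ≡⟨ cong₂ (λ u v → (1ℚ - recip a) * u + recip a * v) (/'≡*recip R b) R/'[xᵢ-x₀] ⟨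
  (1ℚ - recip a) * (R /' b) + recip a * (R /' (xᵢ - x₀))
    ∎
  where
  a b d : ℚ
  a = x₀ - t
  b = xᵢ - t
  d = x₀ - xᵢ
  b+d≡a : (xᵢ - t) + (x₀ - xᵢ) ≡ x₀ - t
  b+d≡a = solve (x₀ ∷ xᵢ ∷ t ∷ []) ℚ-ring
  R/'[xᵢ-x₀] : R /' (xᵢ - x₀) ≡ R * - recip d
  R/'[xᵢ-x₀] = trans (/'≡*recip R (xᵢ - x₀)) (cong (R *_) (recip-sub-swap xᵢ x₀ d≢0))
  split : ∀ A B D → B * D ≡ A * (B + D) → (1ℚ - D) * R * B ≡ (1ℚ - A) * (R * B) + A * (R * - D)
  split A B D BD≡A[B+D] = begin
    (1ℚ - D) * R * B                  ≡⟨ solve (R ∷ B ∷ D ∷ []) ℚ-ring ⟩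
    R * B - R * (B * D)               ≡⟨ cong (λ z → R * B - R * z) BD≡A[B+D] ⟩
    R * B - R * (A * (B + D))         ≡⟨ solve (R ∷ A ∷ B ∷ D ∷ []) ℚ-ring ⟩
    (1ℚ - A) * (R * B) + A * (R * - D) ∎

residue : ∀ {n} → (Fin n → ℚ) → Fin n → ℚ
residue x i = prodExcept i (λ k → (x k - x i - 1ℚ) /' (x k - x i))

Distinct : ∀ {n} → (Fin n → ℚ) → Set
Distinct x = ∀ i k → i ≢ k → x k - x i ≢ 0ℚ

partialFractions : ∀ {n} (x : Fin n → ℚ) t → Distinct x → (∀ i → x i - t ≢ 0ℚ) →
  prod (λ k → (x k - t - 1ℚ) /' (x k - t)) ≡ 1ℚ - sum (λ i → residue x i /' (x i - t))
partialFractions {zero}  x t x-distinct x≢t = refl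
partialFractions {suc n} x t x-distinct x≢t = begin
  (a - 1ℚ) /' a * Π t
    ≡⟨ cong₂ _*_ (pred-/'-self a≢0) (partialFractions x′ t x′-distinct (x≢t ∘ suc)) ⟩
  (1ℚ - recip a) * (1ℚ - S t)
    ≡⟨ regroup (recip a) (S t) (S x₀) ⟩
  1ℚ - ((1ℚ - S x₀) * recip a + ((1ℚ - recip a) * S t + recip a * S x₀))
    ≡⟨ cong₂ (λ u v → 1ℚ - (u + v)) head-term tail-terms ⟨
  1ℚ - (residue x zero /' a + sum (λ i → residue x (suc i) /' (x′ i - t)))
    ∎
  where
  x₀ : ℚ
  x₀ = x zero
  x′ : Fin n → ℚ
  x′ = x ∘ suc
  a : ℚ
  a = x₀ - t
  a≢0 : a ≢ 0ℚ
  a≢0 = x≢t zero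
  x′-distinct : Distinct x′
  x′-distinct i k i≢k = x-distinct (suc i) (suc k) (i≢k ∘ suc-injective)
  Π S : ℚ → ℚ
  Π s = prod (λ k → (x′ k - s - 1ℚ) /' (x′ k - s))
  S s = sum (λ i → residue x′ i /' (x′ i - s))

  regroup : ∀ r S S′ → (1ℚ - r) * (1ℚ - S) ≡ 1ℚ - ((1ℚ - S′) * r + ((1ℚ - r) * S + r * S′))
  regroup = solve-∀ ℚ-ring

  head-term : residue x zero /' a ≡ (1ℚ - S x₀) * recip a
  head-term = begin
    1ℚ * Π x₀ /' a        ≡⟨ /'≡*recip (1ℚ * Π x₀) a ⟩
    1ℚ * Π x₀ * recip a   ≡⟨ cong (_* recip a) (*-identityˡ (Π x₀)) ⟩
    Π x₀ * recip a
      ≡⟨ cong (_* recip a) (partialFractions x′ x₀ x′-distinct (λ i → x-distinct zero (suc i) λ ())) ⟩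
    (1ℚ - S x₀) * recip a
      ∎

  tail-terms : sum (λ i → residue x (suc i) /' (x′ i - t)) ≡ (1ℚ - recip a) * S t + recip a * S x₀
  tail-terms = trans (sum-cong term) (sum-linear (1ℚ - recip a) (recip a)
    (λ i → residue x′ i /' (x′ i - t)) (λ i → residue x′ i /' (x′ i - x₀)))
    where
    term : ∀ i → residue x (suc i) /' (x′ i - t)
               ≡ (1ℚ - recip a) * (residue x′ i /' (x′ i - t)) + recip a * (residue x′ i /' (x′ i - x₀))
    term i = trans (cong (_/' (x′ i - t)) (prodExcept-suc i (λ k → (x k - x (suc i) - 1ℚ) /' (x k - x (suc i)))))
                   (partialFraction-step x₀ (x′ i) t (residue x′ i) a≢0 (x≢t (suc i)) (x-distinct (suc i) zero λ ()))

affineCombination-residueTerms : ∀ x y α P → α ≢ 0ℚ → x - y + α ≢ 0ℚ → x - y ≢ 0ℚ →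
  (1ℚ - (y + 1ℚ - α) /' α) * (P /' (x - y + α)) + (y + 1ℚ - α) /' α * (P /' (x - y))
    ≡ α /' ((x - y + α) * (x - y)) * ((x + 1ℚ - α) /' α) * P
affineCombination-residueTerms x y α P α≢0 v≢0 u≢0 = begin
  (1ℚ - k /' α) * (P /' v) + k /' α * (P /' u)
    ≡⟨ cong (λ c → (1ℚ - c) * (P /' v) + c * (P /' u)) (/'≡*recip k α) ⟩
  (1ℚ - k * recip α) * (P /' v) + k * recip α * (P /' u)
    ≡⟨ cong₂ (λ p q → (1ℚ - k * recip α) * p + k * recip α * q) (/'≡*recip P v) (/'≡*recip P u) ⟩
  (1ℚ - k * recip α) * (P * recip v) + k * recip α * (P * recip u)
    ≡⟨ combine u k (recip α) (recip u) (recip v)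
         (*-recipʳ α≢0) (*-recipʳ u≢0) (recip-partialFraction refl u≢0 α≢0 v≢0) ⟩
  α * (recip v * recip u) * ((u + k) * recip α) * P
    ≡⟨ cong₂ (λ p q → p * q * P) α/'vu [x+1-α]/'α ⟨
  α /' (v * u) * ((x + 1ℚ - α) /' α) * P
    ∎
  where
  u v k : ℚ
  u = x - y
  v = x - y + α
  k = y + 1ℚ - α
  α/'vu : α /' (v * u) ≡ α * (recip v * recip u)
  α/'vu = trans (/'≡*recip α (v * u)) (cong (α *_) (recip-* v≢0 u≢0))
  x+1-α≡u+k : x + 1ℚ - α ≡ (x - y) + (y + 1ℚ - α)
  x+1-α≡u+k = solve (x ∷ y ∷ α ∷ []) ℚ-ring
  [x+1-α]/'α : (x + 1ℚ - α) /' α ≡ (u + k) * recip α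
  [x+1-α]/'α = trans (/'≡*recip (x + 1ℚ - α) α) (cong (_* recip α) x+1-α≡u+k)
  combine : ∀ w c α⁻¹ w⁻¹ [w+α]⁻¹ → α * α⁻¹ ≡ 1ℚ → w * w⁻¹ ≡ 1ℚ → w⁻¹ * α⁻¹ ≡ [w+α]⁻¹ * (w⁻¹ + α⁻¹) →
    (1ℚ - c * α⁻¹) * (P * [w+α]⁻¹) + c * α⁻¹ * (P * w⁻¹) ≡ α * ([w+α]⁻¹ * w⁻¹) * ((w + c) * α⁻¹) * P
  combine w c α⁻¹ w⁻¹ [w+α]⁻¹ αα⁻¹≡1 ww⁻¹≡1 partial = begin
    (1ℚ - c * α⁻¹) * (P * [w+α]⁻¹) + c * α⁻¹ * (P * w⁻¹)
      ≡⟨ solve (P ∷ c ∷ α⁻¹ ∷ w⁻¹ ∷ [w+α]⁻¹ ∷ []) ℚ-ring ⟩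
    P * [w+α]⁻¹ + c * P * (w⁻¹ * α⁻¹ - [w+α]⁻¹ * α⁻¹)
      ≡⟨ cong (λ z → P * [w+α]⁻¹ + c * P * (z - [w+α]⁻¹ * α⁻¹)) partial ⟩
    P * [w+α]⁻¹ + c * P * ([w+α]⁻¹ * (w⁻¹ + α⁻¹) - [w+α]⁻¹ * α⁻¹)
      ≡⟨ solve (P ∷ c ∷ α⁻¹ ∷ w⁻¹ ∷ [w+α]⁻¹ ∷ []) ℚ-ring ⟩
    P * [w+α]⁻¹ * 1ℚ + c * ([w+α]⁻¹ * w⁻¹) * P
      ≡⟨ cong (λ z → P * [w+α]⁻¹ * z + c * ([w+α]⁻¹ * w⁻¹) * P) ww⁻¹≡1 ⟨
    P * [w+α]⁻¹ * (w * w⁻¹) + c * ([w+α]⁻¹ * w⁻¹) * P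
      ≡⟨ solve (P ∷ w ∷ c ∷ w⁻¹ ∷ [w+α]⁻¹ ∷ []) ℚ-ring ⟩
    (w + c) * ([w+α]⁻¹ * w⁻¹) * P * 1ℚ
      ≡⟨ cong ((w + c) * ([w+α]⁻¹ * w⁻¹) * P *_) αα⁻¹≡1 ⟨
    (w + c) * ([w+α]⁻¹ * w⁻¹) * P * (α * α⁻¹)
      ≡⟨ solve (P ∷ w ∷ c ∷ α ∷ α⁻¹ ∷ w⁻¹ ∷ [w+α]⁻¹ ∷ []) ℚ-ring ⟩
    α * ([w+α]⁻¹ * w⁻¹) * ((w + c) * α⁻¹) * P
      ∎

lemma4p5 : (n : ℕ) → 1 ≤ n → (x : Fin n → ℚ) → (y α : ℚ)
  → α ≢ 0ℚ
  → (∀ i → x i - y + α ≢ 0ℚ)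
  → (∀ i → x i - y ≢ 0ℚ)
  → (∀ i k → i ≢ k → x k - x i ≢ 0ℚ)
  → (1ℚ - (y + 1ℚ - α) /' α) * prod (λ i → (x i - y + α - 1ℚ) /' (x i - y + α))
      + ((y + 1ℚ - α) /' α) * prod (λ i → (x i - y - 1ℚ) /' (x i - y))
    ≡ 1ℚ - sum (λ i → (α /' ((x i - y + α) * (x i - y)))
                      * ((x i + 1ℚ - α) /' α)
                      * prodExcept i (λ k → (x k - x i - 1ℚ) /' (x k - x i)))
lemma4p5 n _ x y α α≢0 x-y+α≢0 x-y≢0 x-distinct = begin
  (1ℚ - c) * prod (λ i → (x i - y + α - 1ℚ) /' (x i - y + α)) + c * prod (λ i → (x i - y - 1ℚ) /' (x i - y))
    ≡⟨ cong₂ (λ p q → (1ℚ - c) * p + c * q) shifted (partialFractions x y x-distinct x-y≢0) ⟩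
  (1ℚ - c) * (1ℚ - sum A) + c * (1ℚ - sum B)
    ≡⟨ regroup c (sum A) (sum B) ⟩
  1ℚ - ((1ℚ - c) * sum A + c * sum B)
    ≡⟨ cong (λ S → 1ℚ - S) (sum-linear (1ℚ - c) c A B) ⟨
  1ℚ - sum (λ i → (1ℚ - c) * A i + c * B i)
    ≡⟨ cong (λ S → 1ℚ - S) (sum-cong (λ i → affineCombination-residueTerms (x i) y α (residue x i) α≢0 (x-y+α≢0 i) (x-y≢0 i))) ⟩
  1ℚ - sum (λ i → α /' ((x i - y + α) * (x i - y)) * ((x i + 1ℚ - α) /' α) * residue x i)
    ∎
  where
  c : ℚ
  c = (y + 1ℚ - α) /' α
  A B : Fin n → ℚ
  A i = residue x i /' (x i - y + α)
  B i = residue x i /' (x i - y)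
  regroup : ∀ c S T → (1ℚ - c) * (1ℚ - S) + c * (1ℚ - T) ≡ 1ℚ - ((1ℚ - c) * S + c * T)
  regroup = solve-∀ ℚ-ring
  shift : ∀ z → z - y + α ≡ z - (y - α)
  shift z = solve (z ∷ y ∷ α ∷ []) ℚ-ring
  shifted : prod (λ i → (x i - y + α - 1ℚ) /' (x i - y + α)) ≡ 1ℚ - sum A
  shifted = begin
    prod (λ i → (x i - y + α - 1ℚ) /' (x i - y + α))
      ≡⟨ prod-cong (λ i → cong (λ s → (s - 1ℚ) /' s) (shift (x i))) ⟩
    prod (λ i → (x i - (y - α) - 1ℚ) /' (x i - (y - α)))
      ≡⟨ partialFractions x (y - α) x-distinct (λ i → x-y+α≢0 i ∘ trans (shift (x i))) ⟩
    1ℚ - sum (λ i → residue x i /' (x i - (y - α)))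
      ≡⟨ cong (λ S → 1ℚ - S) (sum-cong (λ i → cong (residue x i /'_) (shift (x i)))) ⟨
    1ℚ - sum A
      ∎
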